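{- Let $G$ be a finite group. The order supergraph $\mathcal{S}(G)$ is the line graph of some graph if and only if $G$ is an EPPO-group and $|G|$ is divisible by at most two distinct primes.
   Context: For a finite group $G$ and $x\in G$, $o(x)$ denotes the order of $x$. The order supergraph $\mathcal{S}(G)$ is the simple undirected graph with vertex set $G$ in which distinct $x,y$ are adjacent if and only if $o(x)\mid o(y)$ or $o(y)\mid o(x)$. An EPPO-group is a finite group in which the order of every element is a power of a prime. The line graph $L(\Gamma)$ of a graph $\Gamma$ has the edges of $\Gamma$ as vertices, two being adjacent if they share an endpoint; a graph is "a line graph" if it is isomorphic to $L(\Gamma)$ for some simple graph $\Gamma$. -}

module Defs where

open import Data.Nat using (ℕ; zero; suc; _<_; _≤_; _^_)
open import Data.Nat.Divisibility using (_∣_)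
open import Data.Nat.Primality using (Prime)
open import Data.Fin using (Fin) renaming (_<_ to _<ᶠ_)
open import Data.Bool using (Bool; true)
open import Data.Product using (Σ; ∃; _×_; _,_; proj₁; proj₂)
open import Data.Sum using (_⊎_)
open import Relation.Nullary using (¬_)
open import Relation.Binary.PropositionalEquality using (_≡_)
open import Algebra.Structures using (IsGroup)
open import Function.Bundles using (_⤖_; Bijection; _⇔_)

-- A finite group, presented (up to isomorphism) on the carrier Fin n.
record FiniteGroup : Set where
  field
    n     : ℕ
    _∙_   : Fin n → Fin n → Fin n
    ε     : Fin n
    _⁻¹   : Fin n → Fin n
    isGroup : IsGroup _≡_ _∙_ ε _⁻¹

module _ (G : FiniteGroup) where
  open FiniteGroup G

  card : ℕ
  card = n

  pow : Fin n → ℕ → Fin n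
  pow x zero    = ε
  pow x (suc k) = x ∙ pow x k

  IsOrder : Fin n → ℕ → Set
  IsOrder x k = (1 ≤ k) × (pow x k ≡ ε) × (∀ j → 1 ≤ j → j < k → ¬ (pow x j ≡ ε))

  SAdj : Fin n → Fin n → Set
  SAdj x y = ¬ (x ≡ y) × Σ ℕ λ a → Σ ℕ λ b →
               IsOrder x a × IsOrder y b × ((a ∣ b) ⊎ (b ∣ a))

  IsEPPO : Set
  IsEPPO = ∀ x → Σ ℕ λ p → Σ ℕ λ k → Prime p × IsOrder x (p ^ k)

  AtMostTwoPrimeDivisors : Set
  AtMostTwoPrimeDivisors = ∀ p q r → Prime p → Prime q → Prime r →
    p ∣ n → q ∣ n → r ∣ n → (p ≡ q) ⊎ (p ≡ r) ⊎ (q ≡ r)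

-- A simple graph on vertex set Fin m, given by a Boolean adjacency function;
-- only pairs u < v are used, so it is automatically loopless and symmetric.
record SimpleGraph : Set where
  field
    m   : ℕ
    adj : Fin m → Fin m → Bool

module _ (Γ : SimpleGraph) where
  open SimpleGraph Γ

  Edge : Set
  Edge = Σ (Fin m) λ u → Σ (Fin m) λ v → (u <ᶠ v) × (adj u v ≡ true)

  src tgt : Edge → Fin m
  src e = proj₁ e
  tgt e = proj₁ (proj₂ e)

  LAdj : Edge → Edge → Set
  LAdj e f = ¬ (e ≡ f) ×
    ((src e ≡ src f) ⊎ (src e ≡ tgt f) ⊎ (tgt e ≡ src f) ⊎ (tgt e ≡ tgt f))

IsLineGraphS : FiniteGroup → Set
IsLineGraphS G = Σ SimpleGraph λ Γ → Σ (Fin (FiniteGroup.n G) ⤖ Edge Γ) λ φ →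
  ∀ x y → SAdj G x y ⇔ LAdj Γ (Bijection.to φ x) (Bijection.to φ y)

-- If S(G) is the line graph L(Γ), no claw and no K₅ minus an edge can occur in it. Three distinct
-- primes dividing |G| give, by Cauchy's theorem, elements of these prime orders which together with ε
-- form a claw; an element w of order p q with p ≠ q gives ε, w, w⁻¹, w ^ q, w ^ p spanning K₅ minus an
-- edge. Conversely, fix a prime P dividing |G|. In an EPPO-group with at most two prime divisors every
-- nonidentity order is a power of P or of one other prime q, and two such orders are comparable exactly
-- when they are powers of the same prime. So S(G) is the line graph of the graph with two hubs (for P
-- and for q) and one leaf per nonidentity element: ε is the edge between the hubs, and every other x is
-- the edge from its leaf to the hub of its prime. Cauchy's theorem is proved by McKay's argument, which
-- counts the p-tuples with product ε modulo p.

module Submission where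

open import Defs
open import Data.Bool as Bool using (Bool; true; false; T; _∧_; _∨_; not; if_then_else_)
open import Data.Bool.Properties using (T-≡; T-∧; T-∨; ∧-zeroʳ; ∧-identityʳ)
open import Data.Empty using (⊥; ⊥-elim)
open import Data.List using (List; []; _∷_; _++_; map; concatMap; length; allFin; tabulate; replicate)
open import Data.List.Properties
  using (map-tabulate; length-tabulate; length-replicate; length-++; ++-assoc; ++-identityʳ; ∷-injectiveˡ; ∷-injectiveʳ; ≡-dec)
open import Data.List.Membership.Propositional using (_∈_)
open import Data.List.Relation.Unary.Any using (here; there; satisfied)
open import Data.List.Membership.Propositional.Properties using (∈-map⁻; ∈-concatMap⁻)
open import Data.Nat
  using (ℕ; zero; suc; _+_; _*_; _∸_; _^_; _≤_; _<_; z≤n; s≤s; _≟_; NonZero; >-nonZero; >-nonZero⁻¹; nonTrivial⇒n>1)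
open import Data.Nat.Properties
open import Data.Nat.Divisibility
  using (_∣_; _∣?_; divides; ∣-refl; ∣-trans; ∣-antisym; ∣⇒≤; 1∣_; ∣1⇒≡1; m∣m*n; n∣m*n; ∣m⇒∣m*n; ∣n⇒∣m*n;
         ∣m+n∣m⇒∣n; *-monoʳ-∣; m%n≡0⇒n∣m)
open import Data.Nat.DivMod using (_%_; _/_; m≡m%n+[m/n]*n; m%n<n)
open import Data.Nat.Primality
  using (Prime; prime[2]; ¬prime[1]; prime⇒irreducible; prime⇒nonTrivial; prime⇒nonZero; euclidsLemma)
open import Data.Nat.Primality.Factorisation using (factorise)
open import Data.Nat.ListAction using (product)
open import Data.List.Relation.Unary.All using (All; []; _∷_)
open import Data.Product using (∃; ∃-syntax; _×_; _,_; proj₁; proj₂)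
open import Data.Sum as Sum using (_⊎_; inj₁; inj₂; [_,_]′)
open import Function using (_∘_; id)
open import Function.Bundles using (Equivalence; _⇔_; _⤖_; Bijection; mk⤖; mk⇔)
open import Function.Consequences.Propositional using (strictlySurjective⇒surjective)
open import Relation.Nullary using (¬_; Dec; yes; no; contradiction; ¬?; _×-dec_)
open import Relation.Nullary.Decidable using (⌊_⌋; toWitness; fromWitness)
open import Relation.Unary using (Decidable)
open import Relation.Binary.Definitions using (DecidableEquality)
open import Relation.Binary.PropositionalEquality
open import Data.Fin as Fin using (Fin; toℕ; zero; suc)
open import Data.Fin.Properties as Fin using (pigeonhole)
open import Level using (0ℓ)
open import Axiom.UniquenessOfIdentityProofs using (module Decidable⇒UIP)
open import Algebra.Bundles using (Group)
open import Algebra.Structures using (IsGroup)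
import Algebra.Properties.Group
import Algebra.Properties.Quasigroup
open import Algebra.Properties.CommutativeSemigroup +-commutativeSemigroup using (interchange)

prime≥2 : ∀ {p} → Prime p → 2 ≤ p
prime≥2 {p} p-prime = nonTrivial⇒n>1 p {{prime⇒nonTrivial p-prime}}

prime≢1 : ∀ {p} → Prime p → ¬ p ≡ 1
prime≢1 p-prime p≡1 = <⇒≢ (prime≥2 p-prime) (sym p≡1)

prime-∣-prime : ∀ {p q} → Prime p → Prime q → p ∣ q → p ≡ q
prime-∣-prime p-prime q-prime p∣q with prime⇒irreducible q-prime p∣q
... | inj₁ refl = contradiction p-prime ¬prime[1]
... | inj₂ p≡q  = p≡q

prime-∣-^ : ∀ {p q} k → Prime p → Prime q → p ∣ q ^ k → p ≡ q
prime-∣-^ zero    p-prime _       p∣1 = contradiction (subst Prime (∣1⇒≡1 p∣1) p-prime) ¬prime[1]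
prime-∣-^ (suc k) p-prime q-prime p∣q^1+k with euclidsLemma _ _ p-prime p∣q^1+k
... | inj₁ p∣q   = prime-∣-prime p-prime q-prime p∣q
... | inj₂ p∣q^k = prime-∣-^ k p-prime q-prime p∣q^k

Comparable : ℕ → ℕ → Set
Comparable a b = a ∣ b ⊎ b ∣ a

distinct-primes-incomparable : ∀ {p q} → Prime p → Prime q → ¬ p ≡ q → ¬ Comparable p q
distinct-primes-incomparable p-prime q-prime p≢q (inj₁ p∣q) = p≢q (prime-∣-prime p-prime q-prime p∣q)
distinct-primes-incomparable p-prime q-prime p≢q (inj₂ q∣p) = p≢q (sym (prime-∣-prime q-prime p-prime q∣p))

^-∣-total : ∀ q a b → Comparable (q ^ a) (q ^ b)
^-∣-total q a b = Sum.map ^-∣-mono ^-∣-mono (≤-total a b)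
  where
  ^-∣-mono : ∀ {a b} → a ≤ b → q ^ a ∣ q ^ b
  ^-∣-mono {a} {b} a≤b = divides (q ^ (b ∸ a)) (trans (cong (q ^_) (sym (m∸n+n≡m a≤b))) (^-distribˡ-+-* q (b ∸ a) a))

private
  power-or-other-prime : ∀ a as → All Prime as →
    product as ≡ a ^ length as ⊎ ∃[ q ] Prime q × ¬ q ≡ a × q ∣ product as
  power-or-other-prime a []       []                 = inj₁ refl
  power-or-other-prime a (b ∷ bs) (b-prime ∷ primes) with b ≟ a | power-or-other-prime a bs primes
  ... | yes refl | inj₁ power            = inj₁ (cong (b *_) power)
  ... | yes refl | inj₂ (q , q-prime , q≢a , q∣) = inj₂ (q , q-prime , q≢a , ∣n⇒∣m*n b q∣)
  ... | no  b≢a  | _                     = inj₂ (b , b-prime , b≢a , m∣m*n _)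

prime-power⊎two-primes : ∀ m .{{_ : NonZero m}} →
  (∃[ p ] ∃[ k ] Prime p × m ≡ p ^ k) ⊎ (∃[ p ] ∃[ q ] Prime p × Prime q × ¬ p ≡ q × p * q ∣ m)
prime-power⊎two-primes m with factorise m
... | record { factors = [] ; isFactorisation = m≡1 } = inj₁ (2 , 0 , prime[2] , m≡1)
... | record { factors = a ∷ as ; isFactorisation = m≡ ; factorsPrime = a-prime ∷ as-prime }
    with power-or-other-prime a as as-prime
...   | inj₁ power = inj₁ (a , suc (length as) , a-prime , trans m≡ (cong (a *_) power))
...   | inj₂ (q , q-prime , q≢a , q∣) =
        inj₂ (a , q , a-prime , q-prime , q≢a ∘ sym , subst (a * q ∣_) (sym m≡) (*-monoʳ-∣ a q∣))

-- Iterated maps and periods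

module _ {P : ℕ → Set} (P? : Decidable P) where

  private
    least-below : ∀ n → (∃[ k ] P k × (∀ j → j < k → ¬ P j)) ⊎ (∀ j → j < n → ¬ P j)
    least-below zero = inj₂ λ _ ()
    least-below (suc n) with least-below n
    ... | inj₁ found = inj₁ found
    ... | inj₂ none with P? n
    ...   | yes Pn = inj₁ (n , Pn , none)
    ...   | no ¬Pn = inj₂ λ j j<1+n → [ none j , (λ { refl → ¬Pn }) ]′ (m<1+n⇒m<n∨m≡n j<1+n)

  least-witness : ∀ {n} → P n → ∃[ k ] P k × (∀ j → j < k → ¬ P j)
  least-witness {n} Pn with least-below (suc n)
  ... | inj₁ found = found
  ... | inj₂ none  = contradiction Pn (none n (n<1+n n))

module _ {A : Set} where

  infixr 30 _^[_]_

  _^[_]_ : (A → A) → ℕ → A → A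
  f ^[ zero  ] a = a
  f ^[ suc k ] a = f (f ^[ k ] a)

  ^[]-+ : ∀ f m n (a : A) → f ^[ m + n ] a ≡ f ^[ m ] f ^[ n ] a
  ^[]-+ f zero    n a = refl
  ^[]-+ f (suc m) n a = cong f (^[]-+ f m n a)

  ^[]-*-fixed : ∀ f {a : A} k q → f ^[ k ] a ≡ a → f ^[ q * k ] a ≡ a
  ^[]-*-fixed f     k zero    fk = refl
  ^[]-*-fixed f {a} k (suc q) fk = begin
    f ^[ k + q * k ] a    ≡⟨ ^[]-+ f k (q * k) a ⟩
    f ^[ k ] f ^[ q * k ] a ≡⟨ cong (f ^[ k ]_) (^[]-*-fixed f k q fk) ⟩
    f ^[ k ] a            ≡⟨ fk ⟩
    a                     ∎
    where open ≡-Reasoning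

  IsPeriod : (A → A) → A → ℕ → Set
  IsPeriod f a k = 1 ≤ k × f ^[ k ] a ≡ a × (∀ j → 1 ≤ j → j < k → ¬ f ^[ j ] a ≡ a)

  module _ {f : A → A} {a : A} where

    ^[]-mod-period : ∀ {k} .{{_ : NonZero k}} → IsPeriod f a k → ∀ m → f ^[ m ] a ≡ f ^[ m % k ] a
    ^[]-mod-period {suc k} (_ , fk , _) m = begin
      f ^[ m ] a                               ≡⟨ cong (λ i → f ^[ i ] a) (m≡m%n+[m/n]*n m (suc k)) ⟩
      f ^[ m % suc k + (m / suc k) * suc k ] a ≡⟨ ^[]-+ f (m % suc k) _ a ⟩
      f ^[ m % suc k ] f ^[ (m / suc k) * suc k ] a ≡⟨ cong (f ^[ m % suc k ]_) (^[]-*-fixed f (suc k) (m / suc k) fk) ⟩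
      f ^[ m % suc k ] a                       ∎
      where open ≡-Reasoning

    period-∣ : ∀ {k m} → IsPeriod f a k → f ^[ m ] a ≡ a → k ∣ m
    period-∣ {suc k} {m} per@(_ , _ , minimal) fm = m%n≡0⇒n∣m m (suc k) remainder≡0
      where
      remainder≡0 : m % suc k ≡ 0
      remainder≡0 with m % suc k | m%n<n m (suc k) | trans (sym (^[]-mod-period per m)) fm
      ... | zero  | _ | _ = refl
      ... | suc r | r<k | fr = contradiction fr (minimal (suc r) (s≤s z≤n) r<k)

    period-unique : ∀ {k l} → IsPeriod f a k → IsPeriod f a l → k ≡ l
    period-unique pk pl = ∣-antisym (period-∣ pk (proj₁ (proj₂ pl))) (period-∣ pl (proj₁ (proj₂ pk)))

    least-period : DecidableEquality A → ∀ {m} → 1 ≤ m → f ^[ m ] a ≡ a → ∃ (IsPeriod f a)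
    least-period _≟ᴬ_ 1≤m fm with least-witness returns? (1≤m , fm)
      where
      returns? : Decidable (λ k → 1 ≤ k × f ^[ k ] a ≡ a)
      returns? zero    = no λ ()
      returns? (suc k) with (f ^[ suc k ] a) ≟ᴬ a
      ... | yes e = yes (s≤s z≤n , e)
      ... | no ¬e = no (¬e ∘ proj₂)
    ... | k , (1≤k , fk) , smaller = k , 1≤k , fk , λ j 1≤j j<k fj → smaller j j<k (1≤j , fj)

    prime-period : DecidableEquality A → ∀ {p} → Prime p → f ^[ p ] a ≡ a → ¬ f a ≡ a → IsPeriod f a p
    prime-period _≟ᴬ_ p-prime fp moves
      with k , per ← least-period _≟ᴬ_ (<⇒≤ (prime≥2 p-prime)) fp
      with prime⇒irreducible p-prime (period-∣ per fp)
    ... | inj₁ refl = contradiction (proj₁ (proj₂ per)) moves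
    ... | inj₂ refl = per

  ^[]-fixed : ∀ {f} {b : A} m → f b ≡ b → f ^[ m ] b ≡ b
  ^[]-fixed zero    fb = refl
  ^[]-fixed {f} (suc m) fb = trans (cong f (^[]-fixed m fb)) fb

χ : Bool → ℕ
χ b = if b then 1 else 0

T-not⁻ : ∀ {b} → T (not b) → ¬ T b
T-not⁻ {true} ()

T-⇔⇒≡ : ∀ {a b} → (T a → T b) → (T b → T a) → a ≡ b
T-⇔⇒≡ {false} {false} _  _    = refl
T-⇔⇒≡ {true}  {true}  _  _    = refl
T-⇔⇒≡ {true}  {false} to _    = ⊥-elim (to _)
T-⇔⇒≡ {false} {true}  _  from = ⊥-elim (from _)

⌊⌋-⇔ : ∀ {X Y : Set} (x? : Dec X) (y? : Dec Y) → (X → Y) → (Y → X) → ⌊ x? ⌋ ≡ ⌊ y? ⌋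
⌊⌋-⇔ x? y? to from = T-⇔⇒≡ (fromWitness ∘ to ∘ toWitness) (fromWitness ∘ from ∘ toWitness)

module _ {A : Set} where

  count : (A → Bool) → List A → ℕ
  count P []       = 0
  count P (x ∷ xs) = χ (P x) + count P xs

  count-cong : ∀ {P Q : A → Bool} xs → (∀ {x} → x ∈ xs → P x ≡ Q x) → count P xs ≡ count Q xs
  count-cong []       P≡Q = refl
  count-cong (x ∷ xs) P≡Q = cong₂ _+_ (cong χ (P≡Q (here refl))) (count-cong xs (P≡Q ∘ there))

  count-split : ∀ (P Q : A → Bool) xs →
    count P xs ≡ count (λ x → P x ∧ Q x) xs + count (λ x → P x ∧ not (Q x)) xs
  count-split P Q []       = refl
  count-split P Q (x ∷ xs) = begin
    χ (P x) + count P xs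
      ≡⟨ cong₂ _+_ (χ-split (P x) (Q x)) (count-split P Q xs) ⟩
    (χ (PQ x) + χ (P¬Q x)) + (count PQ xs + count P¬Q xs)
      ≡⟨ interchange (χ (PQ x)) (χ (P¬Q x)) (count PQ xs) (count P¬Q xs) ⟩
    (χ (PQ x) + count PQ xs) + (χ (P¬Q x) + count P¬Q xs) ∎
    where
    open ≡-Reasoning
    PQ P¬Q : A → Bool
    PQ  y = P y ∧ Q y
    P¬Q y = P y ∧ not (Q y)
    χ-split : ∀ a b → χ a ≡ χ (a ∧ b) + χ (a ∧ not b)
    χ-split false _     = refl
    χ-split true  false = refl
    χ-split true  true  = refl

  count-∨ : ∀ (P Q : A → Bool) xs →
    count (λ x → P x ∨ Q x) xs + count (λ x → P x ∧ Q x) xs ≡ count P xs + count Q xs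
  count-∨ P Q []       = refl
  count-∨ P Q (x ∷ xs) = begin
    (χ (P∨Q x) + count P∨Q xs) + (χ (PQ x) + count PQ xs)
      ≡⟨ interchange (χ (P∨Q x)) (count P∨Q xs) (χ (PQ x)) (count PQ xs) ⟩
    (χ (P∨Q x) + χ (PQ x)) + (count P∨Q xs + count PQ xs)
      ≡⟨ cong₂ _+_ (χ-∨ (P x) (Q x)) (count-∨ P Q xs) ⟩
    (χ (P x) + χ (Q x)) + (count P xs + count Q xs)
      ≡⟨ interchange (χ (P x)) (χ (Q x)) (count P xs) (count Q xs) ⟩
    (χ (P x) + count P xs) + (χ (Q x) + count Q xs) ∎
    where
    open ≡-Reasoning
    P∨Q PQ : A → Bool
    P∨Q y = P y ∨ Q y
    PQ  y = P y ∧ Q y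
    χ-∨ : ∀ a b → χ (a ∨ b) + χ (a ∧ b) ≡ χ a + χ b
    χ-∨ false false = refl
    χ-∨ false true  = refl
    χ-∨ true  false = refl
    χ-∨ true  true  = refl

  count-none : ∀ {P : A → Bool} xs → (∀ {x} → x ∈ xs → ¬ T (P x)) → count P xs ≡ 0
  count-none         []       none = refl
  count-none {P = P} (x ∷ xs) none with P x | none (here refl)
  ... | true  | ¬Px = contradiction _ ¬Px
  ... | false | _   = count-none xs (none ∘ there)

  count≢0⇒∃ : ∀ {P : A → Bool} xs → ¬ count P xs ≡ 0 → ∃[ x ] T (P x)
  count≢0⇒∃         []       nonzero = contradiction refl nonzero
  count≢0⇒∃ {P = P} (x ∷ xs) nonzero with P x in Px
  ... | true  = x , Equivalence.from T-≡ Px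
  ... | false = count≢0⇒∃ xs nonzero

  count-++ : ∀ (P : A → Bool) xs ys → count P (xs ++ ys) ≡ count P xs + count P ys
  count-++ P []       ys = refl
  count-++ P (x ∷ xs) ys = trans (cong (χ (P x) +_) (count-++ P xs ys)) (sym (+-assoc (χ (P x)) _ _))

  count-true : ∀ xs → count (λ _ → true) xs ≡ length xs
  count-true []       = refl
  count-true (x ∷ xs) = cong suc (count-true xs)

module _ {A B : Set} where

  count-map : ∀ (P : A → Bool) (h : B → A) xs → count P (map h xs) ≡ count (P ∘ h) xs
  count-map P h []       = refl
  count-map P h (x ∷ xs) = cong (χ (P (h x)) +_) (count-map P h xs)

  count-concatMap-const : ∀ (P : A → Bool) (h : B → List A) {c} xs →
    (∀ x → count P (h x) ≡ c) → count P (concatMap h xs) ≡ length xs * c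
  count-concatMap-const P h []       each = refl
  count-concatMap-const P h (x ∷ xs) each =
    trans (count-++ P (h x) (concatMap h xs)) (cong₂ _+_ (each x) (count-concatMap-const P h xs each))

  count-concatMap-χ : ∀ (P : A → Bool) (h : B → List A) (Q : B → Bool) xs →
    (∀ x → count P (h x) ≡ χ (Q x)) → count P (concatMap h xs) ≡ count Q xs
  count-concatMap-χ P h Q []       each = refl
  count-concatMap-χ P h Q (x ∷ xs) each =
    trans (count-++ P (h x) (concatMap h xs)) (cong₂ _+_ (each x) (count-concatMap-χ P h Q xs each))

count-allFin-suc : ∀ {n} (P : Fin (suc n) → Bool) →
  count P (allFin (suc n)) ≡ χ (P Fin.zero) + count (P ∘ Fin.suc) (allFin n)
count-allFin-suc {n} P = cong (χ (P Fin.zero) +_) (begin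
  count P (tabulate Fin.suc)           ≡⟨ cong (count P) (map-tabulate id Fin.suc) ⟨
  count P (map Fin.suc (allFin n))     ≡⟨ count-map P Fin.suc (allFin n) ⟩
  count (P ∘ Fin.suc) (allFin n)       ∎)
  where open ≡-Reasoning

count-allFin-true : ∀ n → count (λ _ → true) (allFin n) ≡ n
count-allFin-true n = trans (count-true (allFin n)) (length-tabulate id)

count-allFin-≟ : ∀ {n} (b : Fin n) → count (λ x → ⌊ x Fin.≟ b ⌋) (allFin n) ≡ 1
count-allFin-≟ {suc n} Fin.zero    =
  trans (count-allFin-suc {n} (λ x → ⌊ x Fin.≟ Fin.zero ⌋))
        (cong suc (count-none {P = λ x → ⌊ Fin.suc x Fin.≟ Fin.zero ⌋} (allFin n) λ _ ()))
count-allFin-≟ {suc n} (Fin.suc b) = begin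
  count (λ x → ⌊ x Fin.≟ Fin.suc b ⌋) (allFin (suc n))
    ≡⟨ count-allFin-suc {n} (λ x → ⌊ x Fin.≟ Fin.suc b ⌋) ⟩
  count (λ x → ⌊ Fin.suc x Fin.≟ Fin.suc b ⌋) (allFin n)
    ≡⟨ count-cong (allFin n) (λ {x} _ → ⌊⌋-⇔ (Fin.suc x Fin.≟ Fin.suc b) (x Fin.≟ b) Fin.suc-injective (cong Fin.suc)) ⟩
  count (λ x → ⌊ x Fin.≟ b ⌋) (allFin n)
    ≡⟨ count-allFin-≟ b ⟩
  1 ∎
  where open ≡-Reasoning

-- Points of a p-periodic map, counted modulo p

module FixedPointCount {A : Set} (_≟ᴬ_ : DecidableEquality A) (E : List A)
                       (f : A → A) {p : ℕ} (p-prime : Prime p) where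

  private instance
    p-nonZero : NonZero p
    p-nonZero = prime⇒nonZero p-prime

  isFixed : A → Bool
  isFixed x = ⌊ f x ≟ᴬ x ⌋

  record Invariant (S : A → Bool) : Set where
    field
      closed      : ∀ {x} → T (S x) → T (S (f x))
      periodic    : ∀ {x} → T (S x) → f ^[ p ] x ≡ x
      listed-once : ∀ {x} → T (S x) → count (λ y → ⌊ y ≟ᴬ x ⌋) E ≡ 1

  module Orbit {S : A → Bool} (S-inv : Invariant S) {a : A} (Sa : T (S a)) (moves : ¬ f a ≡ a) where
    open Invariant S-inv

    period : IsPeriod f a p
    period = prime-period _≟ᴬ_ p-prime (periodic Sa) moves

    S-orbit : ∀ j → T (S (f ^[ j ] a))
    S-orbit zero    = Sa
    S-orbit (suc j) = closed (S-orbit j)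

    returns-after : ∀ {j} → j ≤ p → f ^[ p ∸ j ] f ^[ j ] a ≡ a
    returns-after {j} j≤p = begin
      f ^[ p ∸ j ] f ^[ j ] a ≡⟨ ^[]-+ f (p ∸ j) j a ⟨
      f ^[ p ∸ j + j ] a      ≡⟨ cong (λ k → f ^[ k ] a) (m∸n+n≡m j≤p) ⟩
      f ^[ p ] a              ≡⟨ periodic Sa ⟩
      a                       ∎
      where open ≡-Reasoning

    orbit-distinct : ∀ {i j} → i < j → j < p → ¬ f ^[ i ] a ≡ f ^[ j ] a
    orbit-distinct {i} {j} i<j j<p fi≡fj = proj₂ (proj₂ period) (p ∸ j + i) 1≤ <p returns
      where
      1≤ : 1 ≤ p ∸ j + i
      1≤ = ≤-trans (m<n⇒0<n∸m j<p) (m≤m+n (p ∸ j) i)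
      <p : p ∸ j + i < p
      <p = subst (p ∸ j + i <_) (m∸n+n≡m (<⇒≤ j<p)) (+-monoʳ-< (p ∸ j) i<j)
      returns : f ^[ p ∸ j + i ] a ≡ a
      returns = trans (^[]-+ f (p ∸ j) i a) (trans (cong (f ^[ p ∸ j ]_) fi≡fj) (returns-after (<⇒≤ j<p)))

    -- A fixed point is fixed by every iterate, and the orbit returns to a.
    orbit-moves : ∀ {j} → j < p → ¬ f (f ^[ j ] a) ≡ f ^[ j ] a
    orbit-moves {j} j<p fixed = moves (begin
      f a               ≡⟨ cong f a≡fj ⟩
      f (f ^[ j ] a)    ≡⟨ fixed ⟩
      f ^[ j ] a        ≡⟨ a≡fj ⟨
      a                 ∎)
      where
      open ≡-Reasoning
      a≡fj : a ≡ f ^[ j ] a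
      a≡fj = trans (sym (returns-after (<⇒≤ j<p))) (^[]-fixed (p ∸ j) fixed)

    orbitPrefix : ℕ → A → Bool
    orbitPrefix zero    x = false
    orbitPrefix (suc k) x = orbitPrefix k x ∨ ⌊ x ≟ᴬ f ^[ k ] a ⌋

    orbitPrefix-sound : ∀ k {x} → T (orbitPrefix k x) → ∃[ j ] j < k × x ≡ f ^[ j ] a
    orbitPrefix-sound (suc k) {x} x∈ with orbitPrefix k x in eq
    ... | true  = let j , j<k , x≡ = orbitPrefix-sound k (Equivalence.from T-≡ eq) in j , m<n⇒m<1+n j<k , x≡
    ... | false = k , n<1+n k , toWitness x∈

    orbitPrefix-complete : ∀ {k j} → j < k → T (orbitPrefix k (f ^[ j ] a))
    orbitPrefix-complete {suc k} {j} j<1+k with m<1+n⇒m<n∨m≡n j<1+k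
    ... | inj₁ j<k  = Equivalence.from (T-∨ {orbitPrefix k (f ^[ j ] a)}) (inj₁ (orbitPrefix-complete j<k))
    ... | inj₂ refl = Equivalence.from (T-∨ {orbitPrefix j (f ^[ j ] a)}) (inj₂ (fromWitness {a? = f ^[ j ] a ≟ᴬ f ^[ j ] a} refl))

    count-orbitPrefix : ∀ k → k ≤ p → count (orbitPrefix k) E ≡ k
    count-orbitPrefix zero    _   = count-none E (λ _ ())
    count-orbitPrefix (suc k) k<p = begin
      count (orbitPrefix (suc k)) E
        ≡⟨ +-identityʳ _ ⟨
      count (orbitPrefix (suc k)) E + 0
        ≡⟨ cong (count (orbitPrefix (suc k)) E +_) disjoint ⟨
      count (orbitPrefix (suc k)) E + count (λ x → orbitPrefix k x ∧ isNext x) E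
        ≡⟨ count-∨ (orbitPrefix k) isNext E ⟩
      count (orbitPrefix k) E + count isNext E
        ≡⟨ cong₂ _+_ (count-orbitPrefix k (<⇒≤ k<p)) (listed-once (S-orbit k)) ⟩
      k + 1
        ≡⟨ +-comm k 1 ⟩
      suc k ∎
      where
      open ≡-Reasoning
      isNext : A → Bool
      isNext x = ⌊ x ≟ᴬ f ^[ k ] a ⌋
      disjoint : count (λ x → orbitPrefix k x ∧ isNext x) E ≡ 0
      disjoint = count-none E λ {x} _ both →
        let x∈ , x≡ = Equivalence.to T-∧ both
            j , j<k , x≡fj = orbitPrefix-sound k x∈
        in orbit-distinct j<k k<p (trans (sym x≡fj) (toWitness x≡))

    inOrbit : A → Bool
    inOrbit = orbitPrefix p

    rest : A → Bool
    rest x = S x ∧ not (inOrbit x)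

    rest-invariant : Invariant rest
    rest-invariant = record
      { closed      = closed-rest
      ; periodic    = periodic ∘ rest⇒S
      ; listed-once = listed-once ∘ rest⇒S
      }
      where
      rest⇒S : ∀ {x} → T (rest x) → T (S x)
      rest⇒S = proj₁ ∘ Equivalence.to T-∧
      -- x = f ^[ p ∸ 1 ] (f x), so x is in the orbit as soon as f x is.
      closed-rest : ∀ {x} → T (rest x) → T (rest (f x))
      closed-rest {x} rx with Equivalence.to T-∧ rx
      ... | Sx , x∉ with inOrbit (f x) in eq
      ... | false = Equivalence.from T-∧ (closed Sx , _)
      ... | true with j , _ , fx≡fj ← orbitPrefix-sound p (Equivalence.from T-≡ eq) =
        contradiction (subst (T ∘ inOrbit) (sym x≡) (orbitPrefix-complete (m%n<n _ p))) (T-not⁻ x∉)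
        where
        x≡ : x ≡ f ^[ (p ∸ 1 + j) % p ] a
        x≡ = begin
          x                              ≡⟨ periodic Sx ⟨
          f ^[ p ] x                     ≡⟨ cong (λ k → f ^[ k ] x) (m∸n+n≡m (<⇒≤ (prime≥2 p-prime))) ⟨
          f ^[ p ∸ 1 + 1 ] x             ≡⟨ ^[]-+ f (p ∸ 1) 1 x ⟩
          f ^[ p ∸ 1 ] f x               ≡⟨ cong (f ^[ p ∸ 1 ]_) fx≡fj ⟩
          f ^[ p ∸ 1 ] f ^[ j ] a        ≡⟨ ^[]-+ f (p ∸ 1) j a ⟨
          f ^[ p ∸ 1 + j ] a             ≡⟨ ^[]-mod-period period (p ∸ 1 + j) ⟩
          f ^[ (p ∸ 1 + j) % p ] a       ∎
          where open ≡-Reasoning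

    count-S : count S E ≡ count rest E + p
    count-S = begin
      count S E                                   ≡⟨ count-split S inOrbit E ⟩
      count (λ x → S x ∧ inOrbit x) E + count rest E ≡⟨ cong (_+ count rest E) (count-cong E orbit⊆S) ⟩
      count inOrbit E + count rest E              ≡⟨ cong (_+ count rest E) (count-orbitPrefix p ≤-refl) ⟩
      p + count rest E                            ≡⟨ +-comm p _ ⟩
      count rest E + p                            ∎
      where
      open ≡-Reasoning
      orbit⊆S : ∀ {x} → x ∈ E → S x ∧ inOrbit x ≡ inOrbit x
      orbit⊆S {x} _ with inOrbit x in eq
      ... | false = ∧-zeroʳ (S x)
      ... | true  with j , _ , refl ← orbitPrefix-sound p (Equivalence.from T-≡ eq) =
        trans (∧-identityʳ _) (Equivalence.to T-≡ (S-orbit j))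

    count-rest-fixed : count (λ x → rest x ∧ isFixed x) E ≡ count (λ x → S x ∧ isFixed x) E
    count-rest-fixed = count-cong E λ {x} _ → agree x
      where
      agree : ∀ x → (S x ∧ not (inOrbit x)) ∧ isFixed x ≡ S x ∧ isFixed x
      agree x with inOrbit x in eq
      ... | false = cong (_∧ isFixed x) (∧-identityʳ (S x))
      ... | true  with j , j<p , refl ← orbitPrefix-sound p (Equivalence.from T-≡ eq)
                  with isFixed (f ^[ j ] a) in fx
      ... | false = trans (∧-zeroʳ _) (sym (∧-zeroʳ _))
      ... | true  = contradiction (toWitness (Equivalence.from T-≡ fx)) (orbit-moves j<p)

  count≡fixed+multiple : ∀ {S} → Invariant S → ∃[ c ] count S E ≡ count (λ x → S x ∧ isFixed x) E + c * p
  count≡fixed+multiple {S} S-inv = go (count S E) S-inv ≤-refl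
    where
    go : ∀ N {S} → Invariant S → count S E ≤ N → ∃[ c ] count S E ≡ count (λ x → S x ∧ isFixed x) E + c * p
    go N {S} S-inv S≤N with count (λ x → S x ∧ not (isFixed x)) E ≟ 0
    ... | yes none = 0 , trans (count-split S isFixed E) (cong (count (λ x → S x ∧ isFixed x) E +_) none)
    ... | no some with a , Sa∧moves ← count≢0⇒∃ E some with Equivalence.to T-∧ Sa∧moves
    ... | Sa , moves = step N S≤N
      where
      open Orbit S-inv Sa (λ fa≡a → T-not⁻ moves (fromWitness fa≡a))
      rest<S : count rest E < count S E
      rest<S = subst (count rest E <_) (sym count-S) (m<m+n (count rest E) (<-trans (s≤s z≤n) (prime≥2 p-prime)))
      step : ∀ N → count S E ≤ N → ∃[ c ] count S E ≡ count (λ x → S x ∧ isFixed x) E + c * p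
      step zero    S≤0   = contradiction (<-≤-trans rest<S S≤0) (λ ())
      step (suc N) S≤1+N with c , rest≡ ← go N rest-invariant (≤-pred (<-≤-trans rest<S S≤1+N)) = suc c , (begin
        count S E                            ≡⟨ count-S ⟩
        count rest E + p                     ≡⟨ cong (_+ p) rest≡ ⟩
        (count restFixed E + c * p) + p      ≡⟨ cong (λ t → (t + c * p) + p) count-rest-fixed ⟩
        (count SFixed E + c * p) + p         ≡⟨ +-assoc (count SFixed E) (c * p) p ⟩
        count SFixed E + (c * p + p)         ≡⟨ cong (count SFixed E +_) (+-comm (c * p) p) ⟩
        count SFixed E + suc c * p           ∎)
        where
        open ≡-Reasoning
        restFixed SFixed : A → Bool
        restFixed x = rest x ∧ isFixed x
        SFixed    x = S x ∧ isFixed x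

module _ {A : Set} where

  rotate : List A → List A
  rotate []      = []
  rotate (a ∷ u) = u ++ a ∷ []

  rotate^length : ∀ (u w : List A) → rotate ^[ length u ] (u ++ w) ≡ w ++ u
  rotate^length []      w = sym (++-identityʳ w)
  rotate^length (a ∷ u) w = begin
    rotate ^[ suc (length u) ] (a ∷ u ++ w)     ≡⟨ cong (λ k → rotate ^[ k ] (a ∷ u ++ w)) (+-comm 1 (length u)) ⟩
    rotate ^[ length u + 1 ] (a ∷ u ++ w)       ≡⟨ ^[]-+ rotate (length u) 1 (a ∷ u ++ w) ⟩
    rotate ^[ length u ] ((u ++ w) ++ a ∷ [])   ≡⟨ cong (rotate ^[ length u ]_) (++-assoc u w (a ∷ [])) ⟩
    rotate ^[ length u ] (u ++ (w ++ a ∷ []))   ≡⟨ rotate^length u (w ++ a ∷ []) ⟩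
    (w ++ a ∷ []) ++ u                          ≡⟨ ++-assoc w (a ∷ []) u ⟩
    w ++ a ∷ u                                  ∎
    where open ≡-Reasoning

  rotate^length-id : ∀ (u : List A) → rotate ^[ length u ] u ≡ u
  rotate^length-id u = trans (cong (rotate ^[ length u ]_) (sym (++-identityʳ u))) (rotate^length u [])

  rotate-fixed⇒replicate : ∀ (g : A) w → rotate (g ∷ w) ≡ g ∷ w → w ≡ replicate (length w) g
  rotate-fixed⇒replicate g []      _     = refl
  rotate-fixed⇒replicate g (b ∷ w) fixed with refl ← ∷-injectiveˡ fixed =
    cong (b ∷_) (rotate-fixed⇒replicate g w (∷-injectiveʳ fixed))

  rotate-replicate : ∀ k (g : A) → rotate (replicate k g) ≡ replicate k g
  rotate-replicate zero    g = refl
  rotate-replicate (suc k) g = snoc k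
    where
    snoc : ∀ k → replicate k g ++ g ∷ [] ≡ g ∷ replicate k g
    snoc zero    = refl
    snoc (suc k) = cong (g ∷_) (snoc k)

-- Element orders in a finite group

module GroupTheory (G : FiniteGroup) where
  open FiniteGroup G public
  open IsGroup isGroup public using (assoc; identityˡ; identityʳ; inverseˡ; inverseʳ)

  group : Group 0ℓ 0ℓ
  group = record { isGroup = isGroup }

  open Algebra.Properties.Group group public
    using (ε⁻¹≈ε; ⁻¹-injective; ⁻¹-anti-homo-∙; inverseʳ-unique; \\-leftDividesˡ; \\-leftDividesʳ)
  open Algebra.Properties.Quasigroup (Algebra.Properties.Group.quasigroup group) public
    using (cancelˡ; cancelʳ)

  infixr 25 _^ᵍ_

  _^ᵍ_ : Fin n → ℕ → Fin n
  _^ᵍ_ = pow G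

  left-mult-^[] : ∀ y k x → (y ∙_) ^[ k ] x ≡ y ^ᵍ k ∙ x
  left-mult-^[] y zero    x = sym (identityˡ x)
  left-mult-^[] y (suc k) x = trans (cong (y ∙_) (left-mult-^[] y k x)) (sym (assoc y (y ^ᵍ k) x))

  ^ᵍ-+ : ∀ x a b → x ^ᵍ (a + b) ≡ x ^ᵍ a ∙ x ^ᵍ b
  ^ᵍ-+ x zero    b = sym (identityˡ _)
  ^ᵍ-+ x (suc a) b = trans (cong (x ∙_) (^ᵍ-+ x a b)) (sym (assoc _ _ _))

  ^ᵍ-* : ∀ x a b → x ^ᵍ (a * b) ≡ (x ^ᵍ a) ^ᵍ b
  ^ᵍ-* x a zero    = cong (x ^ᵍ_) (*-zeroʳ a)
  ^ᵍ-* x a (suc b) = begin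
    x ^ᵍ (a * suc b)        ≡⟨ cong (x ^ᵍ_) (*-suc a b) ⟩
    x ^ᵍ (a + a * b)        ≡⟨ ^ᵍ-+ x a (a * b) ⟩
    x ^ᵍ a ∙ x ^ᵍ (a * b)   ≡⟨ cong (x ^ᵍ a ∙_) (^ᵍ-* x a b) ⟩
    x ^ᵍ a ∙ (x ^ᵍ a) ^ᵍ b  ∎
    where open ≡-Reasoning

  ε^ᵍ : ∀ k → ε ^ᵍ k ≡ ε
  ε^ᵍ zero    = refl
  ε^ᵍ (suc k) = trans (identityˡ _) (ε^ᵍ k)

  ^ᵍ-comm : ∀ x k → x ∙ x ^ᵍ k ≡ x ^ᵍ k ∙ x
  ^ᵍ-comm x k = trans (cong (x ^ᵍ_) (+-comm 1 k)) (trans (^ᵍ-+ x k 1) (cong (x ^ᵍ k ∙_) (identityʳ x)))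

  ⁻¹-^ᵍ : ∀ x k → (x ⁻¹) ^ᵍ k ≡ (x ^ᵍ k) ⁻¹
  ⁻¹-^ᵍ x zero    = sym ε⁻¹≈ε
  ⁻¹-^ᵍ x (suc k) = begin
    (x ⁻¹) ∙ (x ⁻¹) ^ᵍ k    ≡⟨ cong ((x ⁻¹) ∙_) (⁻¹-^ᵍ x k) ⟩
    (x ⁻¹) ∙ ((x ^ᵍ k) ⁻¹)  ≡⟨ ⁻¹-anti-homo-∙ (x ^ᵍ k) x ⟨
    (x ^ᵍ k ∙ x) ⁻¹       ≡⟨ cong _⁻¹ (^ᵍ-comm x k) ⟨
    (x ∙ x ^ᵍ k) ⁻¹       ∎
    where open ≡-Reasoning

  isOrder⇒isPeriod : ∀ {x k} → IsOrder G x k → IsPeriod (x ∙_) ε k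
  isOrder⇒isPeriod {x} {k} (1≤k , xk , minimal) =
    1≤k , trans (left-mult-^[] x k ε) (trans (identityʳ _) xk) ,
    λ j 1≤j j<k xj → minimal j 1≤j j<k (trans (sym (identityʳ _)) (trans (sym (left-mult-^[] x j ε)) xj))

  isPeriod⇒isOrder : ∀ {x k} → IsPeriod (x ∙_) ε k → IsOrder G x k
  isPeriod⇒isOrder {x} {k} (1≤k , xk , minimal) =
    1≤k , trans (sym (identityʳ _)) (trans (sym (left-mult-^[] x k ε)) xk) ,
    λ j 1≤j j<k xj → minimal j 1≤j j<k (trans (left-mult-^[] x j ε) (trans (identityʳ _) xj))

  order-exists : ∀ x → ∃ (IsOrder G x)
  order-exists x with i , j , i<j , xi≡xj ← pigeonhole (n<1+n n) (λ (i : Fin (suc n)) → x ^ᵍ toℕ i) =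
    let k , per = least-period Fin._≟_ (m<n⇒0<n∸m i<j) returns in k , isPeriod⇒isOrder per
    where
    -- x^i = x^j = x^i ∙ x^(j-i), so x^(j-i) = ε.
    returns : (x ∙_) ^[ toℕ j ∸ toℕ i ] ε ≡ ε
    returns = trans (left-mult-^[] x (toℕ j ∸ toℕ i) ε) (trans (identityʳ _) (cancelˡ (x ^ᵍ toℕ i) _ ε (begin
      x ^ᵍ toℕ i ∙ x ^ᵍ (toℕ j ∸ toℕ i) ≡⟨ ^ᵍ-+ x (toℕ i) _ ⟨
      x ^ᵍ (toℕ i + (toℕ j ∸ toℕ i))     ≡⟨ cong (x ^ᵍ_) (m+[n∸m]≡n (<⇒≤ i<j)) ⟩
      x ^ᵍ toℕ j                         ≡⟨ xi≡xj ⟨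
      x ^ᵍ toℕ i                         ≡⟨ identityʳ _ ⟨
      x ^ᵍ toℕ i ∙ ε                     ∎)))
      where open ≡-Reasoning

  -- Opaque, so that unification never unfolds the pigeonhole search.
  opaque
    order : Fin n → ℕ
    order x = proj₁ (order-exists x)

    order-isOrder : ∀ x → IsOrder G x (order x)
    order-isOrder x = proj₂ (order-exists x)

  order-unique : ∀ {x k l} → IsOrder G x k → IsOrder G x l → k ≡ l
  order-unique ok ol = period-unique (isOrder⇒isPeriod ok) (isOrder⇒isPeriod ol)

  order-∣ : ∀ {x k m} → IsOrder G x k → x ^ᵍ m ≡ ε → k ∣ m
  order-∣ {x} {m = m} ok xm = period-∣ (isOrder⇒isPeriod ok) (trans (left-mult-^[] x m ε) (trans (identityʳ _) xm))

  order-ε : IsOrder G ε 1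
  order-ε = s≤s z≤n , identityʳ ε , λ { j 1≤j (s≤s j≤0) → contradiction (≤-trans 1≤j j≤0) λ () }

  order-1 : ∀ {x} → IsOrder G x 1 → x ≡ ε
  order-1 {x} (_ , x1 , _) = trans (sym (identityʳ x)) x1

  order-≢ : ∀ {x y k l} → IsOrder G x k → IsOrder G y l → ¬ k ≡ l → ¬ x ≡ y
  order-≢ ok ol k≢l refl = k≢l (order-unique ok ol)

  order-^ᵍ : ∀ {x} d e → IsOrder G x (d * e) → IsOrder G (x ^ᵍ d) e
  order-^ᵍ {x} d e (1≤de , xde , minimal) = 1≤e , trans (sym (^ᵍ-* x d e)) xde , minimal′
    where
    instance
      de≢0 : NonZero (d * e)
      de≢0 = >-nonZero 1≤de
    1≤d : 1 ≤ d
    1≤d = >-nonZero⁻¹ d {{m*n≢0⇒m≢0 d}}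
    1≤e : 1 ≤ e
    1≤e = >-nonZero⁻¹ e {{m*n≢0⇒n≢0 d}}
    minimal′ : ∀ j → 1 ≤ j → j < e → ¬ (x ^ᵍ d) ^ᵍ j ≡ ε
    minimal′ j 1≤j j<e xdj =
      minimal (d * j) (*-mono-≤ 1≤d 1≤j) (*-monoʳ-< d {{>-nonZero 1≤d}} j<e) (trans (^ᵍ-* x d j) xdj)

  order-⁻¹ : ∀ {x m} → IsOrder G x m → IsOrder G (x ⁻¹) m
  order-⁻¹ {x} {m} (1≤m , xm , minimal) =
    1≤m , trans (⁻¹-^ᵍ x m) (trans (cong _⁻¹ xm) ε⁻¹≈ε) ,
    λ j 1≤j j<m x⁻¹j → minimal j 1≤j j<m (⁻¹-injective (trans (sym (⁻¹-^ᵍ x j)) (trans x⁻¹j (sym ε⁻¹≈ε))))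

  comparable⇒SAdj : ∀ {x y a b} → ¬ x ≡ y → IsOrder G x a → IsOrder G y b → Comparable a b → SAdj G x y
  comparable⇒SAdj x≢y ox oy a~b = x≢y , _ , _ , ox , oy , a~b

  SAdj⇒comparable : ∀ {x y a b} → IsOrder G x a → IsOrder G y b → SAdj G x y → Comparable a b
  SAdj⇒comparable ox oy (_ , _ , _ , ox′ , oy′ , a~b) = subst₂ Comparable (order-unique ox′ ox) (order-unique oy′ oy) a~b

  ε-SAdj : ∀ {y b} → IsOrder G y b → ¬ b ≡ 1 → SAdj G ε y
  ε-SAdj oy b≢1 = comparable⇒SAdj (order-≢ order-ε oy (b≢1 ∘ sym)) order-ε oy (inj₁ (1∣ _))

  order-prime : ∀ {g p} → Prime p → ¬ g ≡ ε → g ^ᵍ p ≡ ε → IsOrder G g p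
  order-prime {g} p-prime g≢ε gp with prime⇒irreducible p-prime (order-∣ (order-isOrder g) gp)
  ... | inj₁ order≡1 = contradiction (order-1 (subst (IsOrder G g) order≡1 (order-isOrder g))) g≢ε
  ... | inj₂ order≡p = subst (IsOrder G g) order≡p (order-isOrder g)

  -- Left multiplication by y permutes G with no fixed points and y ^ p = ε.
  prime-order⇒∣card : ∀ {y p} → Prime p → IsOrder G y p → p ∣ n
  prime-order⇒∣card {y} {p} p-prime oy@(_ , yp , _) = divides c (begin
    n                                            ≡⟨ count-allFin-true n ⟨
    count (λ _ → true) (allFin n)                ≡⟨ total ⟩
    count (λ x → true ∧ isFixed x) (allFin n) + c * p ≡⟨ cong (_+ c * p) no-fixed ⟩
    c * p                                        ∎)
    where
    open ≡-Reasoning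
    open FixedPointCount Fin._≟_ (allFin n) (y ∙_) p-prime
    invariant : Invariant (λ _ → true)
    invariant = record
      { closed      = λ _ → _
      ; periodic    = λ {x} _ → trans (left-mult-^[] y p x) (trans (cong (_∙ x) yp) (identityˡ x))
      ; listed-once = λ {x} _ → count-allFin-≟ x
      }
    c,total = count≡fixed+multiple invariant
    c = proj₁ c,total
    total = proj₂ c,total
    y≢ε : ¬ y ≡ ε
    y≢ε = order-≢ oy order-ε (prime≢1 p-prime)
    no-fixed : count (λ x → true ∧ isFixed x) (allFin n) ≡ 0
    no-fixed = count-none (allFin n) λ {x} _ fixed → y≢ε (cancelʳ x y ε (trans (toWitness fixed) (sym (identityˡ x))))

  ∣-order⇒order : ∀ {x m k} → IsOrder G x m → k ∣ m → ∃[ y ] IsOrder G y k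
  ∣-order⇒order {x} {k = k} ox (divides d refl) = x ^ᵍ d , order-^ᵍ d k ox

  prime-∣-order⇒∣card : ∀ {x m q} → IsOrder G x m → Prime q → q ∣ m → q ∣ n
  prime-∣-order⇒∣card ox q-prime q∣m = prime-order⇒∣card q-prime (proj₂ (∣-order⇒order ox q∣m))

  prod : List (Fin n) → Fin n
  prod []      = ε
  prod (a ∷ u) = a ∙ prod u

  prod-++ : ∀ u w → prod (u ++ w) ≡ prod u ∙ prod w
  prod-++ []      w = sym (identityˡ _)
  prod-++ (a ∷ u) w = trans (cong (a ∙_) (prod-++ u w)) (sym (assoc _ _ _))

  prod-replicate : ∀ k g → prod (replicate k g) ≡ g ^ᵍ k
  prod-replicate zero    g = refl
  prod-replicate (suc k) g = cong (g ∙_) (prod-replicate k g)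

  ∙≡ε-comm : ∀ a b → a ∙ b ≡ ε → b ∙ a ≡ ε
  ∙≡ε-comm a b ab≡ε = trans (cong (_∙ a) (inverseʳ-unique a b ab≡ε)) (inverseˡ a)

  _≟ᴸ_ : DecidableEquality (List (Fin n))
  _≟ᴸ_ = ≡-dec Fin._≟_

  tuples : ℕ → List (List (Fin n))
  tuples zero    = [] ∷ []
  tuples (suc k) = concatMap (λ g → map (g ∷_) (tuples k)) (allFin n)

  ∈-tuples⇒length : ∀ k {u} → u ∈ tuples k → length u ≡ k
  ∈-tuples⇒length zero    (here refl) = refl
  ∈-tuples⇒length (suc k) u∈ with g , u∈g ← satisfied (∈-concatMap⁻ (λ g → map (g ∷_) (tuples k)) {xs = allFin n} u∈)
                             with w , w∈ , refl ← ∈-map⁻ (g ∷_) u∈g = cong suc (∈-tuples⇒length k w∈)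

  count-tuples-≟ : ∀ k {u} → length u ≡ k → count (λ w → ⌊ w ≟ᴸ u ⌋) (tuples k) ≡ 1
  count-tuples-≟ zero    {[]}    _   = refl
  count-tuples-≟ (suc k) {c ∷ u} len =
    trans (count-concatMap-χ _ _ (λ g → ⌊ g Fin.≟ c ⌋) (allFin n) each) (count-allFin-≟ c)
    where
    each : ∀ g → count (λ w → ⌊ w ≟ᴸ (c ∷ u) ⌋) (map (g ∷_) (tuples k)) ≡ χ ⌊ g Fin.≟ c ⌋
    each g with g Fin.≟ c
    ... | yes refl = trans (count-map _ (g ∷_) (tuples k))
                     (trans (count-cong (tuples k) λ {w} _ → ⌊⌋-⇔ ((g ∷ w) ≟ᴸ (g ∷ u)) (w ≟ᴸ u) ∷-injectiveʳ (cong (g ∷_)))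
                            (count-tuples-≟ k (suc-injective len)))
    ... | no g≢c   = trans (count-map _ (g ∷_) (tuples k))
                     (count-none (tuples k) λ _ gw≡cu → g≢c (∷-injectiveˡ (toWitness gw≡cu)))

  -- The first k entries are free and the last one is forced.
  count-tuples-prod : ∀ k h → count (λ u → ⌊ prod u Fin.≟ h ⌋) (tuples (suc k)) ≡ n ^ k
  count-tuples-prod zero h =
    trans (count-concatMap-χ _ _ (λ g → ⌊ g Fin.≟ h ⌋) (allFin n) each) (count-allFin-≟ h)
    where
    each : ∀ g → count (λ u → ⌊ prod u Fin.≟ h ⌋) (map (g ∷_) (tuples 0)) ≡ χ ⌊ g Fin.≟ h ⌋
    each g = trans (+-identityʳ _) (cong χ (⌊⌋-⇔ (g ∙ ε Fin.≟ h) (g Fin.≟ h) (trans (sym (identityʳ g))) (trans (identityʳ g))))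
  count-tuples-prod (suc k) h =
    trans (count-concatMap-const _ _ (allFin n) each) (cong (_* n ^ k) (length-tabulate {n = n} id))
    where
    each : ∀ g → count (λ u → ⌊ prod u Fin.≟ h ⌋) (map (g ∷_) (tuples (suc k))) ≡ n ^ k
    each g = trans (count-map _ (g ∷_) (tuples (suc k)))
             (trans (count-cong (tuples (suc k)) λ {w} _ → ⌊⌋-⇔ (g ∙ prod w Fin.≟ h) (prod w Fin.≟ (g ⁻¹) ∙ h)
                       (λ e → trans (sym (\\-leftDividesʳ g (prod w))) (cong ((g ⁻¹) ∙_) e))
                       (λ e → trans (cong (g ∙_) e) (\\-leftDividesˡ g h)))
                    (count-tuples-prod k ((g ⁻¹) ∙ h)))

  -- McKay's argument: rotation permutes the p-tuples with product ε, and its fixed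
  -- points are the constant tuples (g, …, g) with g ^ p = ε.
  module McKay {k} (p-prime : Prime (suc k)) (no-order-p : ¬ (∃[ g ] ¬ g ≡ ε × g ^ᵍ suc k ≡ ε)) where

    p : ℕ
    p = suc k

    open FixedPointCount _≟ᴸ_ (tuples p) rotate p-prime

    S : List (Fin n) → Bool
    S u = ⌊ (length u ≟ p) ×-dec (prod u Fin.≟ ε) ⌋

    S-sound : ∀ u → T (S u) → length u ≡ p × prod u ≡ ε
    S-sound u = toWitness {a? = (length u ≟ p) ×-dec (prod u Fin.≟ ε)}

    S-complete : ∀ u → length u ≡ p × prod u ≡ ε → T (S u)
    S-complete u = fromWitness {a? = (length u ≟ p) ×-dec (prod u Fin.≟ ε)}

    rotate-S : ∀ u → length u ≡ p × prod u ≡ ε → length (rotate u) ≡ p × prod (rotate u) ≡ ε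
    rotate-S []      Su               = Su
    rotate-S (a ∷ u) (len , prod≡ε) =
      trans (length-++ u) (trans (+-comm (length u) 1) len) ,
      trans (prod-++ u (a ∷ [])) (trans (cong (prod u ∙_) (identityʳ a)) (∙≡ε-comm a (prod u) prod≡ε))

    S-invariant : Invariant S
    S-invariant = record
      { closed      = λ {u} → S-complete (rotate u) ∘ rotate-S u ∘ S-sound u
      ; periodic    = λ {u} Su → subst (λ m → rotate ^[ m ] u ≡ u) (proj₁ (S-sound u Su)) (rotate^length-id u)
      ; listed-once = λ {u} → count-tuples-≟ p ∘ proj₁ ∘ S-sound u
      }

    count-S : count S (tuples p) ≡ n ^ k
    count-S = trans (count-cong (tuples p) λ {u} u∈ →
                       ⌊⌋-⇔ ((length u ≟ p) ×-dec (prod u Fin.≟ ε)) (prod u Fin.≟ ε) proj₂ (∈-tuples⇒length p u∈ ,_))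
                    (count-tuples-prod k ε)

    ε-tuple : List (Fin n)
    ε-tuple = replicate p ε

    fixed⇒ε-tuple : ∀ u → length u ≡ p × prod u ≡ ε → rotate u ≡ u → u ≡ ε-tuple
    fixed⇒ε-tuple (g ∷ w) (len , prod≡ε) fixed = trans u≡ (cong (replicate p) g≡ε)
      where
      u≡ : g ∷ w ≡ replicate p g
      u≡ = cong (g ∷_) (trans (rotate-fixed⇒replicate g w fixed) (cong (λ m → replicate m g) (suc-injective len)))
      g≡ε : g ≡ ε
      g≡ε with g Fin.≟ ε
      ... | yes g≡ε = g≡ε
      ... | no  g≢ε = contradiction (g , g≢ε , trans (sym (prod-replicate p g)) (trans (cong prod (sym u≡)) prod≡ε)) no-order-p

    S∧isFixed⇔ε-tuple : ∀ u → S u ∧ isFixed u ≡ ⌊ u ≟ᴸ ε-tuple ⌋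
    S∧isFixed⇔ε-tuple u = T-⇔⇒≡ to from
      where
      to : T (S u ∧ isFixed u) → T ⌊ u ≟ᴸ ε-tuple ⌋
      to Su∧fixed with Su , fixed ← Equivalence.to (T-∧ {S u}) Su∧fixed =
        fromWitness (fixed⇒ε-tuple u (S-sound u Su) (toWitness {a? = rotate u ≟ᴸ u} fixed))
      from : T ⌊ u ≟ᴸ ε-tuple ⌋ → T (S u ∧ isFixed u)
      from u≡ with refl ← toWitness {a? = u ≟ᴸ ε-tuple} u≡ = Equivalence.from (T-∧ {S ε-tuple})
        (S-complete ε-tuple (length-replicate p , trans (prod-replicate p ε) (ε^ᵍ p)) ,
         fromWitness {a? = rotate ε-tuple ≟ᴸ ε-tuple} (rotate-replicate p ε))

    count-fixed : count (λ u → S u ∧ isFixed u) (tuples p) ≡ 1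
    count-fixed = trans (count-cong (tuples p) λ {u} _ → S∧isFixed⇔ε-tuple u) (count-tuples-≟ p (length-replicate p))

    n^k≡1-mod-p : ∃[ c ] n ^ k ≡ c * p + 1
    n^k≡1-mod-p with c , total ← count≡fixed+multiple S-invariant =
      c , trans (sym count-S) (trans total (trans (cong (_+ c * p) count-fixed) (+-comm 1 (c * p))))

  cauchy : ∀ {p} → Prime p → p ∣ n → ∃[ g ] IsOrder G g p
  cauchy {zero}            ()
  cauchy {suc zero}        ()
  cauchy {p@(suc (suc k))} p-prime p∣n with Fin.any? (λ g → ¬? (g Fin.≟ ε) ×-dec (g ^ᵍ p Fin.≟ ε))
  ... | yes (g , g≢ε , gp) = g , order-prime p-prime g≢ε gp
  ... | no  none with c , n^k≡ ← McKay.n^k≡1-mod-p p-prime none =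
    contradiction (∣1⇒≡1 (∣m+n∣m⇒∣n (subst (p ∣_) n^k≡ (∣m⇒∣m*n (n ^ k) p∣n)) (n∣m*n c))) λ ()

-- Two forbidden configurations in line graphs

module _ {V : Set} where

  two-of-three : ∀ {c₁ c₂ a₁ a₂ a₃ : V} → (a₁ ≡ c₁ ⊎ a₁ ≡ c₂) → (a₂ ≡ c₁ ⊎ a₂ ≡ c₂) → (a₃ ≡ c₁ ⊎ a₃ ≡ c₂) →
    a₁ ≡ a₂ ⊎ a₁ ≡ a₃ ⊎ a₂ ≡ a₃
  two-of-three (inj₁ x) (inj₁ y) _        = inj₁ (trans x (sym y))
  two-of-three (inj₂ x) (inj₂ y) _        = inj₁ (trans x (sym y))
  two-of-three (inj₁ x) (inj₂ y) (inj₁ z) = inj₂ (inj₁ (trans x (sym z)))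
  two-of-three (inj₁ x) (inj₂ y) (inj₂ z) = inj₂ (inj₂ (trans y (sym z)))
  two-of-three (inj₂ x) (inj₁ y) (inj₁ z) = inj₂ (inj₂ (trans y (sym z)))
  two-of-three (inj₂ x) (inj₁ y) (inj₂ z) = inj₂ (inj₁ (trans x (sym z)))

  ExactlyOneAgrees : V → V → V → V → Set
  ExactlyOneAgrees a a′ b b′ = (a ≡ a′ ⊎ b ≡ b′) × ¬ (a ≡ a′ × b ≡ b′)

  private
    flip-agrees : ∀ {a a′ b b′} → ExactlyOneAgrees a a′ b b′ → ExactlyOneAgrees a′ a b′ b
    flip-agrees (inj₁ x , d) = inj₁ (sym x) , λ (x , y) → d (sym x , sym y)
    flip-agrees (inj₂ y , d) = inj₂ (sym y) , λ (x , y) → d (sym x , sym y)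

    corner : ∀ {a₁ a₂ a₃ b₁ b₂ b₃ : V} → a₁ ≡ a₂ → b₁ ≡ b₃ →
      ExactlyOneAgrees a₁ a₂ b₁ b₂ → ExactlyOneAgrees a₁ a₃ b₁ b₃ → ExactlyOneAgrees a₂ a₃ b₂ b₃ → ⊥
    corner a₁₂ b₁₃ (_ , d₁₂) (_ , d₁₃) (inj₁ a₂₃ , _) = d₁₃ (trans a₁₂ a₂₃ , b₁₃)
    corner a₁₂ b₁₃ (_ , d₁₂) (_ , d₁₃) (inj₂ b₂₃ , _) = d₁₂ (a₁₂ , trans b₁₃ (sym b₂₃))

  no-three-exactly-one-agrees : ∀ {a₁ a₂ a₃ b₁ b₂ b₃ : V} →
    a₁ ≡ a₂ ⊎ a₁ ≡ a₃ ⊎ a₂ ≡ a₃ → b₁ ≡ b₂ ⊎ b₁ ≡ b₃ ⊎ b₂ ≡ b₃ →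
    ExactlyOneAgrees a₁ a₂ b₁ b₂ → ExactlyOneAgrees a₁ a₃ b₁ b₃ → ExactlyOneAgrees a₂ a₃ b₂ b₃ → ⊥
  no-three-exactly-one-agrees (inj₁ a₁₂) (inj₁ b₁₂) e₁₂ e₁₃ e₂₃ =
    proj₂ e₁₂ (a₁₂ , b₁₂)
  no-three-exactly-one-agrees (inj₁ a₁₂) (inj₂ (inj₁ b₁₃)) e₁₂ e₁₃ e₂₃ =
    corner a₁₂ b₁₃ e₁₂ e₁₃ e₂₃
  no-three-exactly-one-agrees (inj₁ a₁₂) (inj₂ (inj₂ b₂₃)) e₁₂ e₁₃ e₂₃ =
    corner (sym a₁₂) b₂₃ (flip-agrees e₁₂) e₂₃ e₁₃
  no-three-exactly-one-agrees (inj₂ (inj₁ a₁₃)) (inj₁ b₁₂) e₁₂ e₁₃ e₂₃ =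
    corner a₁₃ b₁₂ e₁₃ e₁₂ (flip-agrees e₂₃)
  no-three-exactly-one-agrees (inj₂ (inj₁ a₁₃)) (inj₂ (inj₁ b₁₃)) e₁₂ e₁₃ e₂₃ =
    proj₂ e₁₃ (a₁₃ , b₁₃)
  no-three-exactly-one-agrees (inj₂ (inj₁ a₁₃)) (inj₂ (inj₂ b₂₃)) e₁₂ e₁₃ e₂₃ =
    corner (sym a₁₃) (sym b₂₃) (flip-agrees e₁₃) (flip-agrees e₂₃) e₁₂
  no-three-exactly-one-agrees (inj₂ (inj₂ a₂₃)) (inj₁ b₁₂) e₁₂ e₁₃ e₂₃ =
    corner a₂₃ (sym b₁₂) e₂₃ (flip-agrees e₁₂) (flip-agrees e₁₃)
  no-three-exactly-one-agrees (inj₂ (inj₂ a₂₃)) (inj₂ (inj₁ b₁₃)) e₁₂ e₁₃ e₂₃ =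
    corner (sym a₂₃) (sym b₁₃) (flip-agrees e₂₃) (flip-agrees e₁₃) (flip-agrees e₁₂)
  no-three-exactly-one-agrees (inj₂ (inj₂ a₂₃)) (inj₂ (inj₂ b₂₃)) e₁₂ e₁₃ e₂₃ =
    proj₂ e₂₃ (a₂₃ , b₂₃)

module LineGraph (Γ : SimpleGraph) where
  open SimpleGraph Γ

  infix 4 _∈ᵉ_

  _∈ᵉ_ : Fin m → Edge Γ → Set
  v ∈ᵉ e = v ≡ src Γ e ⊎ v ≡ tgt Γ e

  Meet : Edge Γ → Edge Γ → Set
  Meet e f = (src Γ e ≡ src Γ f) ⊎ (src Γ e ≡ tgt Γ f) ⊎ (tgt Γ e ≡ src Γ f) ⊎ (tgt Γ e ≡ tgt Γ f)

  Independent : Edge Γ → Edge Γ → Set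
  Independent e f = ¬ e ≡ f × ¬ LAdj Γ e f

  meet⇒common : ∀ {e f} → Meet e f → ∃[ v ] v ∈ᵉ e × v ∈ᵉ f
  meet⇒common (inj₁ x)                 = _ , inj₁ refl , inj₁ x
  meet⇒common (inj₂ (inj₁ x))          = _ , inj₁ refl , inj₂ x
  meet⇒common (inj₂ (inj₂ (inj₁ x)))   = _ , inj₂ refl , inj₁ x
  meet⇒common (inj₂ (inj₂ (inj₂ x)))   = _ , inj₂ refl , inj₂ x

  common⇒meet : ∀ {v e f} → v ∈ᵉ e → v ∈ᵉ f → Meet e f
  common⇒meet (inj₁ refl) (inj₁ y) = inj₁ y
  common⇒meet (inj₁ refl) (inj₂ y) = inj₂ (inj₁ y)
  common⇒meet (inj₂ refl) (inj₁ y) = inj₂ (inj₂ (inj₁ y))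
  common⇒meet (inj₂ refl) (inj₂ y) = inj₂ (inj₂ (inj₂ y))

  independent⇒disjoint : ∀ {v e f} → Independent e f → v ∈ᵉ e → v ∈ᵉ f → ⊥
  independent⇒disjoint {v} {e} {f} (e≢f , ¬adj) v∈e v∈f = ¬adj (e≢f , common⇒meet {v} {e} {f} v∈e v∈f)

  src<tgt : ∀ e → src Γ e Fin.< tgt Γ e
  src<tgt e = proj₁ (proj₂ (proj₂ e))

  edge-≡ : ∀ {e f} → src Γ e ≡ src Γ f → tgt Γ e ≡ tgt Γ f → e ≡ f
  edge-≡ {u , v , u<v , uv} {_ , _ , u<v′ , uv′} refl refl =
    cong₂ (λ lt adj → u , v , lt , adj) (Fin.<-irrelevant u<v u<v′) (Decidable⇒UIP.≡-irrelevant Bool._≟_ uv uv′)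

  ends⇒≡ : ∀ {e f} → src Γ e ∈ᵉ f → tgt Γ e ∈ᵉ f → e ≡ f
  ends⇒≡ {e}     (inj₁ x) (inj₁ y) = contradiction (src<tgt e) (Fin.<-irrefl (trans x (sym y)))
  ends⇒≡         (inj₁ x) (inj₂ y) = edge-≡ x y
  ends⇒≡ {e} {f} (inj₂ x) (inj₁ y) = ⊥-elim (Fin.<-asym (src<tgt f) (subst₂ Fin._<_ x y (src<tgt e)))
  ends⇒≡ {e}     (inj₂ x) (inj₂ y) = contradiction (src<tgt e) (Fin.<-irrefl (trans x (sym y)))

  -- An edge has only two endpoints, so two of three edges meeting it meet each other.
  no-claw : ∀ {c l₁ l₂ l₃} → LAdj Γ c l₁ → LAdj Γ c l₂ → LAdj Γ c l₃ →
    Independent l₁ l₂ → Independent l₁ l₃ → Independent l₂ l₃ → ⊥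
  no-claw {c} {l₁} {l₂} {l₃} (_ , m₁) (_ , m₂) (_ , m₃) i₁₂ i₁₃ i₂₃
    with v₁ , v₁∈c , v₁∈l₁ ← meet⇒common {c} {l₁} m₁
       | v₂ , v₂∈c , v₂∈l₂ ← meet⇒common {c} {l₂} m₂
       | v₃ , v₃∈c , v₃∈l₃ ← meet⇒common {c} {l₃} m₃
    with two-of-three v₁∈c v₂∈c v₃∈c
  ... | inj₁ refl        = independent⇒disjoint {e = l₁} i₁₂ v₁∈l₁ v₂∈l₂
  ... | inj₂ (inj₁ refl) = independent⇒disjoint {e = l₁} i₁₃ v₁∈l₁ v₃∈l₃
  ... | inj₂ (inj₂ refl) = independent⇒disjoint {e = l₂} i₂₃ v₂∈l₂ v₃∈l₃

  module Crossings {y z : Edge Γ} (y⊥z : Independent y z) where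

    record Crossing (e : Edge Γ) : Set where
      field
        a b : Fin m
        a∈y : a ∈ᵉ y
        a∈e : a ∈ᵉ e
        b∈z : b ∈ᵉ z
        b∈e : b ∈ᵉ e

    open Crossing

    crossing : ∀ {e} → LAdj Γ e y → LAdj Γ e z → Crossing e
    crossing {e} (_ , e-y) (_ , e-z)
      with a , a∈e , a∈y ← meet⇒common {e} {y} e-y
         | b , b∈e , b∈z ← meet⇒common {e} {z} e-z =
      record { a = a ; b = b ; a∈y = a∈y ; a∈e = a∈e ; b∈z = b∈z ; b∈e = b∈e }

    -- a ≠ b since y and z are disjoint, so {a, b} are the two endpoints of e.
    crossing-ends : ∀ {e} (C : Crossing e) {v} → v ∈ᵉ e → v ≡ a C ⊎ v ≡ b C
    crossing-ends {e} C v∈e = ends v∈e (a∈e C) (b∈e C)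
      where
      a≢b : ¬ a C ≡ b C
      a≢b a≡b = independent⇒disjoint {e = y} y⊥z (a∈y C) (subst (_∈ᵉ z) (sym a≡b) (b∈z C))
      ends : ∀ {v} → v ∈ᵉ e → a C ∈ᵉ e → b C ∈ᵉ e → v ≡ a C ⊎ v ≡ b C
      ends (inj₁ v≡) (inj₁ a≡) _         = inj₁ (trans v≡ (sym a≡))
      ends (inj₂ v≡) (inj₂ a≡) _         = inj₁ (trans v≡ (sym a≡))
      ends (inj₁ v≡) (inj₂ _)  (inj₁ b≡) = inj₂ (trans v≡ (sym b≡))
      ends (inj₁ _)  (inj₂ a≡) (inj₂ b≡) = contradiction (trans a≡ (sym b≡)) a≢b
      ends (inj₂ _)  (inj₁ a≡) (inj₁ b≡) = contradiction (trans a≡ (sym b≡)) a≢b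
      ends (inj₂ v≡) (inj₁ _)  (inj₂ b≡) = inj₂ (trans v≡ (sym b≡))

    crossing-meet : ∀ {e f} (C : Crossing e) (D : Crossing f) → Meet e f → a C ≡ a D ⊎ b C ≡ b D
    crossing-meet {e} {f} C D e-f with v , v∈e , v∈f ← meet⇒common {e} {f} e-f
                                  with crossing-ends C v∈e | crossing-ends D v∈f
    ... | inj₁ x | inj₁ x′ = inj₁ (trans (sym x) x′)
    ... | inj₂ x | inj₂ x′ = inj₂ (trans (sym x) x′)
    ... | inj₁ x | inj₂ x′ =
      ⊥-elim (independent⇒disjoint {e = y} y⊥z (subst (_∈ᵉ y) (sym x) (a∈y C)) (subst (_∈ᵉ z) (sym x′) (b∈z D)))
    ... | inj₂ x | inj₁ x′ =
      ⊥-elim (independent⇒disjoint {e = y} y⊥z (subst (_∈ᵉ y) (sym x′) (a∈y D)) (subst (_∈ᵉ z) (sym x) (b∈z C)))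

    crossing-≢ : ∀ {e f} (C : Crossing e) (D : Crossing f) → ¬ e ≡ f → ¬ (a C ≡ a D × b C ≡ b D)
    crossing-≢ {e} {f} C D e≢f (a≡ , b≡) = e≢f (ends⇒≡ (to-f (inj₁ refl)) (to-f (inj₂ refl)))
      where
      to-f : ∀ {v} → v ∈ᵉ e → v ∈ᵉ f
      to-f v∈e with crossing-ends C v∈e
      ... | inj₁ v≡a = subst (_∈ᵉ f) (sym (trans v≡a a≡)) (a∈e D)
      ... | inj₂ v≡b = subst (_∈ᵉ f) (sym (trans v≡b b≡)) (b∈e D)

    crossing-adj : ∀ {e f} (C : Crossing e) (D : Crossing f) → LAdj Γ e f → ExactlyOneAgrees (a C) (a D) (b C) (b D)
    crossing-adj C D (e≢f , e-f) = crossing-meet C D e-f , crossing-≢ C D e≢f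

  -- Each eᵢ joins an endpoint of y to an endpoint of z, and three distinct such edges cannot pairwise meet.
  no-K₅-minus-edge : ∀ {y z e₁ e₂ e₃} → Independent y z →
    LAdj Γ e₁ y → LAdj Γ e₁ z → LAdj Γ e₂ y → LAdj Γ e₂ z → LAdj Γ e₃ y → LAdj Γ e₃ z →
    LAdj Γ e₁ e₂ → LAdj Γ e₁ e₃ → LAdj Γ e₂ e₃ → ⊥
  no-K₅-minus-edge y⊥z e₁y e₁z e₂y e₂z e₃y e₃z e₁₂ e₁₃ e₂₃ =
    no-three-exactly-one-agrees
      (two-of-three (a∈y C₁) (a∈y C₂) (a∈y C₃)) (two-of-three (b∈z C₁) (b∈z C₂) (b∈z C₃))
      (crossing-adj C₁ C₂ e₁₂) (crossing-adj C₁ C₃ e₁₃) (crossing-adj C₂ C₃ e₂₃)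
    where
    open Crossings y⊥z
    open Crossing
    C₁ = crossing e₁y e₁z
    C₂ = crossing e₂y e₂z
    C₃ = crossing e₃y e₃z

-- From a line graph to EPPO with at most two prime divisors

module LineGraph⇒EPPO (G : FiniteGroup) (Γ : SimpleGraph) (φ : Fin (FiniteGroup.n G) ⤖ Edge Γ)
                      (φ-adj : ∀ x y → SAdj G x y ⇔ LAdj Γ (Bijection.to φ x) (Bijection.to φ y)) where
  open GroupTheory G
  open LineGraph Γ
  open Bijection φ using (to; injective)

  to-LAdj : ∀ {x y} → SAdj G x y → LAdj Γ (to x) (to y)
  to-LAdj {x} {y} = Equivalence.to (φ-adj x y)

  to-Independent : ∀ {x y} → ¬ x ≡ y → ¬ SAdj G x y → Independent (to x) (to y)
  to-Independent {x} {y} x≢y ¬adj = x≢y ∘ injective , ¬adj ∘ Equivalence.from (φ-adj x y)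

  prime-orders-independent : ∀ {x y p q} → Prime p → Prime q → ¬ p ≡ q →
    IsOrder G x p → IsOrder G y q → Independent (to x) (to y)
  prime-orders-independent p-prime q-prime p≢q ox oy =
    to-Independent (order-≢ ox oy p≢q) (distinct-primes-incomparable p-prime q-prime p≢q ∘ SAdj⇒comparable ox oy)

  -- Elements of three distinct prime orders, all adjacent to ε, would form a claw.
  at-most-two-primes : AtMostTwoPrimeDivisors G
  at-most-two-primes p q r p-prime q-prime r-prime p∣n q∣n r∣n with p ≟ q | p ≟ r | q ≟ r
  ... | yes p≡q | _       | _       = inj₁ p≡q
  ... | no  _   | yes p≡r | _       = inj₂ (inj₁ p≡r)
  ... | no  _   | no  _   | yes q≡r = inj₂ (inj₂ q≡r)
  ... | no  p≢q | no  p≢r | no  q≢r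
      with x , ox ← cauchy p-prime p∣n | y , oy ← cauchy q-prime q∣n | z , oz ← cauchy r-prime r∣n =
    ⊥-elim (no-claw (to-LAdj (ε-SAdj ox (prime≢1 p-prime)))
                    (to-LAdj (ε-SAdj oy (prime≢1 q-prime)))
                    (to-LAdj (ε-SAdj oz (prime≢1 r-prime)))
                    (prime-orders-independent p-prime q-prime p≢q ox oy)
                    (prime-orders-independent p-prime r-prime p≢r ox oz)
                    (prime-orders-independent q-prime r-prime q≢r oy oz))

  -- An element w of order p q yields K₅ minus an edge on ε, w, w⁻¹, w ^ q, w ^ p.
  no-order-of-two-primes : ∀ {w p q} → Prime p → Prime q → ¬ p ≡ q → IsOrder G w (p * q) → ⊥
  no-order-of-two-primes {w} {p} {q} p-prime q-prime p≢q ow =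
    no-K₅-minus-edge (prime-orders-independent p-prime q-prime p≢q oy oz)
      (to-LAdj (ε-SAdj oy (prime≢1 p-prime)))  (to-LAdj (ε-SAdj oz (prime≢1 q-prime)))
      (divisor-adj ow oy (m∣m*n q) pq≢p)       (divisor-adj ow oz (n∣m*n p) pq≢q)
      (divisor-adj ow⁻¹ oy (m∣m*n q) pq≢p)     (divisor-adj ow⁻¹ oz (n∣m*n p) pq≢q)
      (to-LAdj (ε-SAdj ow pq≢1))               (to-LAdj (ε-SAdj ow⁻¹ pq≢1))
      (to-LAdj (comparable⇒SAdj w≢w⁻¹ ow ow⁻¹ (inj₁ ∣-refl)))
    where
    instance
      p≢0 : NonZero p
      p≢0 = prime⇒nonZero p-prime
      q≢0 : NonZero q
      q≢0 = prime⇒nonZero q-prime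

    y = w ^ᵍ q
    z = w ^ᵍ p

    oy : IsOrder G y p
    oy = order-^ᵍ q p (subst (IsOrder G w) (*-comm p q) ow)
    oz : IsOrder G z q
    oz = order-^ᵍ p q ow
    ow⁻¹ : IsOrder G (w ⁻¹) (p * q)
    ow⁻¹ = order-⁻¹ ow

    pq≢p : ¬ p * q ≡ p
    pq≢p = <⇒≢ (m<m*n p q (prime≥2 q-prime)) ∘ sym
    pq≢q : ¬ p * q ≡ q
    pq≢q = <⇒≢ (subst (q <_) (*-comm q p) (m<m*n q p (prime≥2 p-prime))) ∘ sym
    4≤pq : 4 ≤ p * q
    4≤pq = *-mono-≤ (prime≥2 p-prime) (prime≥2 q-prime)
    pq≢1 : ¬ p * q ≡ 1
    pq≢1 pq≡1 = contradiction (subst (4 ≤_) pq≡1 4≤pq) λ { (s≤s ()) }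

    divisor-adj : ∀ {x y a b} → IsOrder G x a → IsOrder G y b → b ∣ a → ¬ a ≡ b → LAdj Γ (to x) (to y)
    divisor-adj ox oy b∣a a≢b = to-LAdj (comparable⇒SAdj (order-≢ ox oy a≢b) ox oy (inj₂ b∣a))

    -- w = w⁻¹ would give w ^ 2 = ε, so p q ∣ 2.
    w≢w⁻¹ : ¬ w ≡ w ⁻¹
    w≢w⁻¹ w≡w⁻¹ = <⇒≱ (≤-trans (s≤s (s≤s (s≤s z≤n))) 4≤pq) (∣⇒≤ (order-∣ ow w²≡ε))
      where
      w²≡ε : w ^ᵍ 2 ≡ ε
      w²≡ε = trans (cong (w ∙_) (identityʳ w)) (trans (cong (w ∙_) w≡w⁻¹) (inverseʳ w))

  eppo : IsEPPO G
  eppo x with prime-power⊎two-primes (order x) {{>-nonZero (proj₁ (order-isOrder x))}}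
  ... | inj₁ (p , k , p-prime , order≡) = p , k , p-prime , subst (IsOrder G x) order≡ (order-isOrder x)
  ... | inj₂ (p , q , p-prime , q-prime , p≢q , pq∣order) =
    ⊥-elim (no-order-of-two-primes p-prime q-prime p≢q (proj₂ (∣-order⇒order (order-isOrder x) pq∣order)))

-- From EPPO with at most two prime divisors to a line graph

module EPPO⇒LineGraph (G : FiniteGroup) (eppo : IsEPPO G) (two-primes : AtMostTwoPrimeDivisors G) where
  open GroupTheory G

  instance
    n≢0 : NonZero n
    n≢0 = Fin.nonZeroIndex ε

  -- For |G| = 1 any prime will do.
  hub-prime : ∃[ P ] Prime P × (∀ {q} → Prime q → q ∣ n → P ∣ n)
  hub-prime with factorise n
  ... | record { factors = [] ; isFactorisation = n≡1 } =
    2 , prime[2] , λ q-prime q∣n → contradiction (subst Prime (∣1⇒≡1 (subst (_ ∣_) n≡1 q∣n)) q-prime) ¬prime[1]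
  ... | record { factors = a ∷ _ ; isFactorisation = n≡ ; factorsPrime = a-prime ∷ _ } =
    a , a-prime , λ _ _ → subst (a ∣_) (sym n≡) (m∣m*n _)

  opaque
    P : ℕ
    P = proj₁ hub-prime

    P-prime : Prime P
    P-prime = proj₁ (proj₂ hub-prime)

    P-∣-card : ∀ {q} → Prime q → q ∣ n → P ∣ n
    P-∣-card = proj₂ (proj₂ hub-prime)

  data Kind (x : Fin n) : Set where
    identity : x ≡ ε → Kind x
    P-power  : ¬ x ≡ ε → P ∣ order x → Kind x
    other    : ¬ x ≡ ε → ¬ P ∣ order x → Kind x

  kind : ∀ x → Kind x
  kind x with x Fin.≟ ε | P ∣? order x
  ... | yes x≡ε | _       = identity x≡ε
  ... | no  x≢ε | yes P∣x = P-power x≢ε P∣x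
  ... | no  x≢ε | no  P∤x = other x≢ε P∤x

  order-prime-power : ∀ x → ¬ x ≡ ε → ∃[ q ] ∃[ k ] Prime q × order x ≡ q ^ suc k
  order-prime-power x x≢ε with eppo x
  ... | q , zero  , q-prime , ox = contradiction (order-1 ox) x≢ε
  ... | q , suc k , q-prime , ox = q , k , q-prime , order-unique (order-isOrder x) ox

  order-P-power : ∀ {x} → ¬ x ≡ ε → P ∣ order x → ∃[ k ] order x ≡ P ^ suc k
  order-P-power {x} x≢ε P∣x with q , k , q-prime , ox ← order-prime-power x x≢ε =
    k , trans ox (cong (_^ suc k) (sym (prime-∣-^ (suc k) P-prime q-prime (subst (P ∣_) ox P∣x))))

  order-other : ∀ {x} → ¬ x ≡ ε → ¬ P ∣ order x →
    ∃[ q ] ∃[ k ] Prime q × ¬ q ≡ P × q ∣ n × order x ≡ q ^ suc k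
  order-other {x} x≢ε P∤x with q , k , q-prime , ox ← order-prime-power x x≢ε =
    q , k , q-prime , q≢P , prime-∣-order⇒∣card (order-isOrder x) q-prime q∣x , ox
    where
    q∣x : q ∣ order x
    q∣x = subst (q ∣_) (sym ox) (m∣m*n _)
    q≢P : ¬ q ≡ P
    q≢P refl = P∤x q∣x

  P-powers-comparable : ∀ {x y} → ¬ x ≡ ε → P ∣ order x → ¬ y ≡ ε → P ∣ order y → Comparable (order x) (order y)
  P-powers-comparable x≢ε P∣x y≢ε P∣y
    with a , ox ← order-P-power x≢ε P∣x | b , oy ← order-P-power y≢ε P∣y =
    subst₂ Comparable (sym ox) (sym oy) (^-∣-total P (suc a) (suc b))

  others-comparable : ∀ {x y} → ¬ x ≡ ε → ¬ P ∣ order x → ¬ y ≡ ε → ¬ P ∣ order y → Comparable (order x) (order y)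
  others-comparable x≢ε P∤x y≢ε P∤y
    with q , a , q-prime , q≢P , q∣n , ox ← order-other x≢ε P∤x
       | r , b , r-prime , r≢P , r∣n , oy ← order-other y≢ε P∤y
    with two-primes P q r P-prime q-prime r-prime (P-∣-card q-prime q∣n) q∣n r∣n
  ... | inj₁ P≡q        = contradiction (sym P≡q) q≢P
  ... | inj₂ (inj₁ P≡r) = contradiction (sym P≡r) r≢P
  ... | inj₂ (inj₂ refl) = subst₂ Comparable (sym ox) (sym oy) (^-∣-total q (suc a) (suc b))

  P-power-other-incomparable : ∀ {x y} → ¬ x ≡ ε → P ∣ order x → ¬ y ≡ ε → ¬ P ∣ order y →
    ¬ Comparable (order x) (order y)
  P-power-other-incomparable x≢ε P∣x y≢ε P∤y (inj₁ x∣y) = P∤y (∣-trans P∣x x∣y)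
  P-power-other-incomparable x≢ε P∣x y≢ε P∤y (inj₂ y∣x)
    with a , ox ← order-P-power x≢ε P∣x | q , b , q-prime , q≢P , _ , oy ← order-other y≢ε P∤y =
    q≢P (prime-∣-^ (suc a) q-prime P-prime (subst (q ∣_) ox (∣-trans (subst (q ∣_) (sym oy) (m∣m*n _)) y∣x)))

  -- Two hubs 0 and 1 and a leaf 2 + x for each x: ε is the edge between the hubs,
  -- and every other x joins its leaf to hub 0 or hub 1 according to whether P ∣ o(x).
  adj : Fin (2 + n) → Fin (2 + n) → Bool
  adj zero       (suc zero)    = true
  adj zero       (suc (suc x)) = ⌊ ¬? (x Fin.≟ ε) ×-dec (P ∣? order x) ⌋
  adj (suc zero) (suc (suc x)) = ⌊ ¬? (x Fin.≟ ε) ×-dec ¬? (P ∣? order x) ⌋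
  adj _          _             = false

  Γ : SimpleGraph
  Γ = record { m = 2 + n ; adj = adj }

  open LineGraph Γ using (Meet; edge-≡)

  edge : ∀ x → Kind x → Edge Γ
  edge x (identity _)     = zero , suc zero , s≤s z≤n , refl
  edge x (P-power x≢ε P∣x) = zero , suc (suc x) , s≤s z≤n , Equivalence.to T-≡ (fromWitness (x≢ε , P∣x))
  edge x (other x≢ε P∤x)  = suc zero , suc (suc x) , s≤s (s≤s z≤n) , Equivalence.to T-≡ (fromWitness (x≢ε , P∤x))

  φ : Fin n → Edge Γ
  φ x = edge x (kind x)

  edge-unique : ∀ {x} (k k′ : Kind x) → edge x k ≡ edge x k′
  edge-unique (identity _)     (identity _)     = edge-≡ refl refl
  edge-unique (P-power _ _)    (P-power _ _)    = edge-≡ refl refl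
  edge-unique (other _ _)      (other _ _)      = edge-≡ refl refl
  edge-unique (identity x≡ε)   (P-power x≢ε _)  = contradiction x≡ε x≢ε
  edge-unique (identity x≡ε)   (other x≢ε _)    = contradiction x≡ε x≢ε
  edge-unique (P-power x≢ε _)  (identity x≡ε)   = contradiction x≡ε x≢ε
  edge-unique (other x≢ε _)    (identity x≡ε)   = contradiction x≡ε x≢ε
  edge-unique (P-power _ P∣x)  (other _ P∤x)    = contradiction P∣x P∤x
  edge-unique (other _ P∤x)    (P-power _ P∣x)  = contradiction P∣x P∤x

  decode : Edge Γ → Fin n
  decode (_ , suc (suc x) , _) = x
  decode _                     = ε

  decode-edge : ∀ {x} (k : Kind x) → decode (edge x k) ≡ x
  decode-edge (identity x≡ε) = sym x≡ε
  decode-edge (P-power _ _)  = refl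
  decode-edge (other _ _)    = refl

  edge-decode : ∀ e → φ (decode e) ≡ e
  edge-decode e@(zero , suc zero , _ , _) = trans (edge-unique (kind ε) (identity refl)) (edge-≡ refl refl)
  edge-decode e@(zero , suc (suc x) , _ , x∈A) with x≢ε , P∣x ← toWitness (Equivalence.from T-≡ x∈A) =
    trans (edge-unique (kind x) (P-power x≢ε P∣x)) (edge-≡ refl refl)
  edge-decode e@(suc zero , suc (suc x) , _ , x∈B) with x≢ε , P∤x ← toWitness (Equivalence.from T-≡ x∈B) =
    trans (edge-unique (kind x) (other x≢ε P∤x)) (edge-≡ refl refl)
  edge-decode (zero , zero , () , _)
  edge-decode (suc zero , zero , () , _)
  edge-decode (suc zero , suc zero , s≤s () , _)
  edge-decode (suc (suc _) , zero , _ , ())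
  edge-decode (suc (suc _) , suc zero , _ , ())
  edge-decode (suc (suc _) , suc (suc _) , _ , ())

  φ-injective : ∀ {x y} → φ x ≡ φ y → x ≡ y
  φ-injective {x} {y} φx≡φy = trans (sym (decode-edge (kind x))) (trans (cong decode φx≡φy) (decode-edge (kind y)))

  φ-bijection : Fin n ⤖ Edge Γ
  φ-bijection = mk⤖ {to = φ} (φ-injective , strictlySurjective⇒surjective λ e → decode e , edge-decode e)

  order-identity : ∀ {x} → x ≡ ε → order x ≡ 1
  order-identity refl = order-unique (order-isOrder ε) order-ε

  meet⇒comparable : ∀ {x y} (kx : Kind x) (ky : Kind y) → ¬ x ≡ y → Meet (edge x kx) (edge y ky) →
    Comparable (order x) (order y)
  meet⇒comparable (identity x≡ε)    _                 _   _ = inj₁ (subst (_∣ _) (sym (order-identity x≡ε)) (1∣ _))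
  meet⇒comparable (P-power _ _)     (identity y≡ε)    _   _ = inj₂ (subst (_∣ _) (sym (order-identity y≡ε)) (1∣ _))
  meet⇒comparable (other _ _)       (identity y≡ε)    _   _ = inj₂ (subst (_∣ _) (sym (order-identity y≡ε)) (1∣ _))
  meet⇒comparable (P-power x≢ε P∣x) (P-power y≢ε P∣y) _   _ = P-powers-comparable x≢ε P∣x y≢ε P∣y
  meet⇒comparable (other x≢ε P∤x)   (other y≢ε P∤y)   _   _ = others-comparable x≢ε P∤x y≢ε P∤y
  meet⇒comparable (P-power _ _)     (other _ _)       x≢y (inj₂ (inj₂ (inj₂ leaf≡))) =
    contradiction (Fin.suc-injective (Fin.suc-injective leaf≡)) x≢y
  meet⇒comparable (other _ _)       (P-power _ _)     x≢y (inj₂ (inj₂ (inj₂ leaf≡))) =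
    contradiction (Fin.suc-injective (Fin.suc-injective leaf≡)) x≢y

  comparable⇒meet : ∀ {x y} (kx : Kind x) (ky : Kind y) → ¬ x ≡ y → Comparable (order x) (order y) →
    Meet (edge x kx) (edge y ky)
  comparable⇒meet (identity x≡ε)    (identity y≡ε)    x≢y _ = contradiction (trans x≡ε (sym y≡ε)) x≢y
  comparable⇒meet (identity _)      (P-power _ _)     _   _ = inj₁ refl
  comparable⇒meet (identity _)      (other _ _)       _   _ = inj₂ (inj₂ (inj₁ refl))
  comparable⇒meet (P-power _ _)     (identity _)      _   _ = inj₁ refl
  comparable⇒meet (other _ _)       (identity _)      _   _ = inj₂ (inj₁ refl)
  comparable⇒meet (P-power _ _)     (P-power _ _)     _   _ = inj₁ refl
  comparable⇒meet (other _ _)       (other _ _)       _   _ = inj₁ refl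
  comparable⇒meet (P-power x≢ε P∣x) (other y≢ε P∤y)   _   x~y =
    contradiction x~y (P-power-other-incomparable x≢ε P∣x y≢ε P∤y)
  comparable⇒meet (other x≢ε P∤x)   (P-power y≢ε P∣y) _   x~y =
    contradiction (Sum.swap x~y) (P-power-other-incomparable y≢ε P∣y x≢ε P∤x)

  φ-adj : ∀ x y → SAdj G x y ⇔ LAdj Γ (φ x) (φ y)
  φ-adj x y = mk⇔
    (λ x~y@(x≢y , _) → x≢y ∘ φ-injective ,
       comparable⇒meet (kind x) (kind y) x≢y (SAdj⇒comparable (order-isOrder x) (order-isOrder y) x~y))
    (λ (φx≢φy , meet) → let x≢y = φx≢φy ∘ cong φ in
       comparable⇒SAdj x≢y (order-isOrder x) (order-isOrder y) (meet⇒comparable (kind x) (kind y) x≢y meet))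

  isLineGraph : IsLineGraphS G
  isLineGraph = Γ , φ-bijection , φ-adj

mainTheorem1 : (G : FiniteGroup) → IsLineGraphS G ⇔ (IsEPPO G × AtMostTwoPrimeDivisors G)
mainTheorem1 G = mk⇔
  (λ (Γ , φ , φ-adj) → let open LineGraph⇒EPPO G Γ φ φ-adj in eppo , at-most-two-primes)
  (λ (eppo , two-primes) → EPPO⇒LineGraph.isLineGraph G eppo two-primes)
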